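{- Let $\mathcal{I}=\{C_1,\dots,C_m\}$ be an instance of \textsc{Monotone 3-Sat-$(2,2)$}. If $\mathcal{I}$ has the property that $C_j\in\mathcal{I}$ implies $\overline{C_j}\in\mathcal{I}$, where $\overline{C_j}$ is obtained from $C_j$ by negating each literal, then $\mathcal{I}$ is satisfiable.
   Context: A literal is a variable $x$ or its negation $\overline{x}$ (with $\overline{\overline{x}}=x$). A clause is a set of literals; it is monotone if all its literals are unnegated or all are negated. A truth assignment satisfies a clause if it makes at least one literal true; a formula is satisfiable if some truth assignment satisfies all its clauses. An instance of \textsc{Monotone 3-Sat-$(2,2)$} is a set of clauses $\{C_1,\dots,C_m\}$ over variables $V$ such that each $C_j$ is a monotone clause with exactly three distinct variables, no clause is duplicated, and amongst the clauses each variable appears unnegated exactly twice and negated exactly twice. -}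

module Defs where

open import Data.Nat using (ℕ)
open import Data.Fin using (Fin)
open import Data.Bool using (Bool; true; false; not; _∨_)
open import Data.List using (List; length; filter)
open import Data.List.Relation.Unary.All using (All)
open import Data.List.Relation.Unary.Any using (Any)
open import Data.List.Relation.Unary.AllPairs using (AllPairs)
open import Data.List.Membership.Propositional using (_∈_)
open import Data.Product using (_×_; Σ; ∃)
open import Relation.Binary.PropositionalEquality using (_≡_; _≢_)
open import Relation.Nullary using (¬_)
open import Relation.Nullary.Decidable using (_×-dec_; _⊎-dec_)
open import Data.Sum using (_⊎_)
open import Data.Fin using (_≟_)
open import Data.Bool using () renaming (_≟_ to _≟ᵇ_)

-- A literal over variables Fin n: a variable together with a polarity
-- (true = unnegated x, false = negated x̄).
record Literal (n : ℕ) : Set where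
  constructor lit
  field
    var  : Fin n
    sign : Bool

negLit : ∀ {n} → Literal n → Literal n
negLit (lit x s) = lit x (not s)

-- A monotone clause with exactly three distinct variables: all literals share
-- polarity 'sign'; the variables x₁, x₂, x₃ are pairwise distinct.
-- (The clause is the set {(x₁,sign),(x₂,sign),(x₃,sign)}.)
record MClause (n : ℕ) : Set where
  constructor mclause
  field
    sign : Bool
    x₁ x₂ x₃ : Fin n
    d₁₂ : x₁ ≢ x₂
    d₁₃ : x₁ ≢ x₃
    d₂₃ : x₂ ≢ x₃

open MClause

_∈vars_ : ∀ {n} → Fin n → MClause n → Set
x ∈vars C = x ≡ x₁ C ⊎ x ≡ x₂ C ⊎ x ≡ x₃ C

_∈ᶜ_ : ∀ {n} → Literal n → MClause n → Set
lit x s ∈ᶜ C = s ≡ sign C × x ∈vars C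

SameClause : ∀ {n} → MClause n → MClause n → Set
SameClause C D = ∀ ℓ → (ℓ ∈ᶜ C → ℓ ∈ᶜ D) × (ℓ ∈ᶜ D → ℓ ∈ᶜ C)

occurs? : ∀ {n} → (ℓ : Literal n) → (C : MClause n) →
          Relation.Nullary.Dec (ℓ ∈ᶜ C)
occurs? (lit x s) C =
  (s ≟ᵇ sign C) ×-dec ((x ≟ x₁ C) ⊎-dec ((x ≟ x₂ C) ⊎-dec (x ≟ x₃ C)))

occ : ∀ {n} → Literal n → List (MClause n) → ℕ
occ ℓ I = length (filter (occurs? ℓ) I)

negClause : ∀ {n} → MClause n → MClause n
negClause (mclause s a b c p q r) = mclause (not s) a b c p q r

record IsM3Sat22 {n : ℕ} (I : List (MClause n)) : Set where
  field
    noDup  : AllPairs (λ C D → ¬ SameClause C D) I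
    posTwo : ∀ (x : Fin n) → occ (lit x true) I ≡ 2
    negTwo : ∀ (x : Fin n) → occ (lit x false) I ≡ 2

Assignment : ℕ → Set
Assignment n = Fin n → Bool

litTrue : ∀ {n} → Assignment n → Literal n → Set
litTrue α (lit x s) = α x ≡ s

SatClause : ∀ {n} → Assignment n → MClause n → Set
SatClause α C = ∃ λ ℓ → ℓ ∈ᶜ C × litTrue α ℓ

Satisfiable : ∀ {n} → List (MClause n) → Set
Satisfiable I = ∃ λ α → All (SatClause α) I

NegClosed : ∀ {n} → List (MClause n) → Set
NegClosed I = All (λ C → Any (SameClause (negClause C)) I) I

-- Call an assignment α *proper* on a list of clauses if every positive
-- clause receives both truth values under α (it is bichromatic).  A bichromatic
-- clause is satisfied whatever its sign, and in a negation-closed instance every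
-- negative clause C has the same variables as the positive clause C̄ ∈ I.  So it
-- suffices to find a proper assignment, i.e. a proper 2-colouring of the
-- 3-uniform hypergraph of positive clauses, where every variable has degree 2.
--
-- We prove the stronger pinning lemma: if every variable lies in at
-- most two positive clauses, then two variables a, b of degree ≤ 1 may be given
-- any (consistent) prescribed values.  By induction on the number of clauses:
-- if a lies in a positive clause e, remove e, pick a third variable y of e
-- distinct from a and b, pin b and y (to ¬ of a's value) in the rest, and then
-- set a, which now occurs nowhere else; symmetrically for b; if neither occurs,
-- colour the rest freely and set a and b.  Free colouring of e ∷ R in turn pins
-- two variables of e to opposite values in R.
module Submission where

open import Defs
open import Data.Nat using (ℕ; zero; suc; _≤_; s≤s⁻¹)
open import Data.Nat.Properties using (≤-trans; ≤-reflexive; n≤1+n; <⇒≱)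
open import Data.Fin using (Fin; _≟_)
open import Data.Bool using (Bool; true; false; not)
open import Data.List using (List; []; _∷_; length)
open import Data.List.Properties using (filter-accept; filter-reject; filter-some)
open import Data.List.Relation.Unary.All as All using (All; []; _∷_)
open import Data.List.Relation.Unary.All.Properties using (¬Any⇒All¬)
open import Data.List.Relation.Unary.Any as Any using (Any; here; there; any?)
open import Data.List.Relation.Binary.Permutation.Propositional
  using (_↭_; prep; swap; ↭-refl; ↭-sym; ↭-trans)
open import Data.List.Relation.Binary.Permutation.Propositional.Properties
  using (All-resp-↭; filter-↭; ↭-length)
open import Data.Vec.Functional using (updateAt)
open import Data.Vec.Functional.Properties using (updateAt-updates; updateAt-minimal)
open import Data.Product using (_×_; _,_; ∃; ∃₂; proj₁; proj₂)
open import Data.Sum using (_⊎_; inj₁; inj₂)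
open import Data.Empty using (⊥-elim)
open import Function using (const; _∘′_)
open import Relation.Nullary using (¬_; yes; no)
open import Relation.Binary.PropositionalEquality
  using (_≡_; _≢_; refl; sym; trans; cong; subst; ≢-sym)

open MClause

private
  variable
    n k m : ℕ
    α : Assignment n
    v w a b : Fin n
    c ca cb : Bool
    C D e : MClause n
    H R : List (MClause n)

_[_≔_] : Assignment n → Fin n → Bool → Assignment n
α [ v ≔ c ] = updateAt α v (const c)

Bichromatic : Assignment n → MClause n → Set
Bichromatic α C = ∀ c → ∃ λ w → w ∈vars C × α w ≡ c

Proper : Assignment n → List (MClause n) → Set
Proper α H = All (λ C → sign C ≡ true → Bichromatic α C) H

deg : Fin n → List (MClause n) → ℕ
deg v H = occ (lit v true) H

PinnedColouring : List (MClause n) → Fin n → Bool → Fin n → Bool → Set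
PinnedColouring H a ca b cb = ∃ λ α → Proper α H × α a ≡ ca × α b ≡ cb

Unused : Fin n → List (MClause n) → Set
Unused v H = All (λ C → ¬ lit v true ∈ᶜ C) H

Sparse : List (MClause n) → Set
Sparse H = ∀ v → deg v H ≤ 2

bichromatic⇒satisfied : Bichromatic α C → SatClause α C
bichromatic⇒satisfied {C = C} bichromatic =
  let w , w∈C , αw = bichromatic (sign C) in lit w (sign C) , (refl , w∈C) , αw

opposite⇒bichromatic : ∀ c → v ∈vars C → w ∈vars C → α v ≡ c → α w ≡ not c →
                       Bichromatic α C
opposite⇒bichromatic {v = v} {w = w} true  v∈C w∈C αv αw true  = v , v∈C , αv
opposite⇒bichromatic {v = v} {w = w} true  v∈C w∈C αv αw false = w , w∈C , αw
opposite⇒bichromatic {v = v} {w = w} false v∈C w∈C αv αw true  = w , w∈C , αw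
opposite⇒bichromatic {v = v} {w = w} false v∈C w∈C αv αw false = v , v∈C , αv

sameClause-sign : SameClause C D → sign C ≡ sign D
sameClause-sign {C = C} same =
  proj₁ (proj₁ (same (lit (x₁ C) (sign C))) (refl , inj₁ refl))

sameClause-vars : SameClause C D → w ∈vars D → w ∈vars C
sameClause-vars {D = D} {w = w} same w∈D =
  proj₂ (proj₂ (same (lit w (sign D))) (refl , w∈D))

bichromatic-resp : SameClause C D → Bichromatic α D → Bichromatic α C
bichromatic-resp {C = C} {D = D} same bichromatic c =
  let w , w∈D , αw = bichromatic c
  in w , sameClause-vars {C = C} {D = D} same w∈D , αw

complement⇒bichromatic : (sign C ≡ true → Bichromatic α C) →
                         SameClause (negClause C) D →
                         (sign D ≡ true → Bichromatic α D) → Bichromatic α C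
complement⇒bichromatic {C = mclause true  _ _ _ _ _ _} properC _ _ = properC refl
complement⇒bichromatic {C = C@(mclause false _ _ _ _ _ _)} {α = α} {D = D}
                       _ same properD =
  bichromatic-resp {C = negClause C} {D = D} {α = α} same
    (properD (sym (sameClause-sign {C = negClause C} {D = D} same)))

negClosed⇒bichromatic : ∀ {I : List (MClause n)} → NegClosed I → Proper α I →
                        All (Bichromatic α) I
negClosed⇒bichromatic {α = α} {I = I} closed proper =
  All.zipWith (λ {C} → bichromaticAt {C}) (proper , closed)
  where
  bichromaticAt : ∀ {C} → (sign C ≡ true → Bichromatic α C) ×
                  Any (SameClause (negClause C)) I → Bichromatic α C
  bichromaticAt {C} (properC , complementInI) =
    let properD , same = All.lookupAny proper complementInI
    in complement⇒bichromatic {C = C} {α = α} {D = Any.lookup complementInI}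
                              properC same properD

flip-pins : (a ≡ b → ca ≡ cb) → b ≡ a → cb ≡ ca
flip-pins consistent b≡a = sym (consistent (sym b≡a))

update-keeps : (b ≡ a → cb ≡ ca) → α a ≡ ca → (α [ b ≔ cb ]) a ≡ ca
update-keeps {b = b} {a = a} {α = α} consistent αa with a ≟ b
... | yes refl = trans (updateAt-updates a α) (consistent refl)
... | no a≢b   = trans (updateAt-minimal a b α a≢b) αa

update-unused : Unused v H → Proper α H → Proper (α [ v ≔ c ]) H
update-unused {v = v} {α = α} {c = c} unused proper =
  All.zipWith (λ {C} → keep {C}) (unused , proper)
  where
  keep : ∀ {C} → ¬ lit v true ∈ᶜ C × (sign C ≡ true → Bichromatic α C) →
         sign C ≡ true → Bichromatic (α [ v ≔ c ]) C
  keep (v∉C , properC) positive c′ =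
    let w , w∈C , αw = properC positive c′
        w≢v : w ≢ v
        w≢v = λ { refl → v∉C (sym positive , w∈C) }
    in w , w∈C , trans (updateAt-minimal w v α w≢v) αw

pin-unused : Unused a H → Unused b H → (a ≡ b → ca ≡ cb) → Proper α H →
             PinnedColouring H a ca b cb
pin-unused {a = a} {b = b} {ca = ca} {cb = cb} {α = α}
           unusedA unusedB consistent proper =
  α [ a ≔ ca ] [ b ≔ cb ] ,
  update-unused {α = α [ a ≔ ca ]} unusedB (update-unused {α = α} unusedA proper) ,
  update-keeps (flip-pins consistent) (updateAt-updates a α) ,
  updateAt-updates b _

deg-↭ : H ↭ R → deg v H ≤ m → deg v R ≤ m
deg-↭ {v = v} H↭R = subst (_≤ _) (↭-length (filter-↭ (occurs? (lit v true)) H↭R))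

deg-accept : lit v true ∈ᶜ C → deg v (C ∷ H) ≡ suc (deg v H)
deg-accept {v = v} {H = H} v∈C =
  cong length (filter-accept (occurs? (lit v true)) {xs = H} v∈C)

deg-reject : ¬ lit v true ∈ᶜ C → deg v (C ∷ H) ≡ deg v H
deg-reject {v = v} {H = H} v∉C =
  cong length (filter-reject (occurs? (lit v true)) {xs = H} v∉C)

deg-tail : deg v H ≤ deg v (C ∷ H)
deg-tail {v = v} {H = H} {C = C} with occurs? (lit v true) C
... | yes v∈C = subst (_ ≤_) (sym (deg-accept {H = H} v∈C)) (n≤1+n _)
... | no v∉C  = ≤-reflexive (sym (deg-reject {H = H} v∉C))

deg-head : lit v true ∈ᶜ C → deg v (C ∷ H) ≤ suc m → deg v H ≤ m
deg-head {H = H} v∈C = s≤s⁻¹ ∘′ subst (_≤ _) (deg-accept {H = H} v∈C)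

deg-zero : deg v H ≤ 0 → Unused v H
deg-zero {v = v} {H = H} deg≤0 =
  ¬Any⇒All¬ H λ occurs → <⇒≱ (filter-some (occurs? (lit v true)) occurs) deg≤0

sparse-tail : ∀ C → Sparse (C ∷ H) → Sparse H
sparse-tail {H = H} C sparse v = ≤-trans (deg-tail {v = v} {H = H} {C = C}) (sparse v)

extract : ∀ {P : MClause n → Set} → Any P H → ∃₂ λ e R → P e × H ↭ e ∷ R
extract (here pe)  = _ , _ , pe , ↭-refl
extract (there pH) =
  let e , R , pe , H↭e∷R = extract pH
  in e , _ ∷ R , pe , ↭-trans (prep _ H↭e∷R) (swap _ _ ↭-refl)

one-of-two-avoids : v ≢ w → (b : Fin n) → v ≢ b ⊎ w ≢ b
one-of-two-avoids {v = v} v≢w b with v ≟ b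
... | no v≢b   = inj₁ v≢b
... | yes refl = inj₂ (≢-sym v≢w)

third-variable : (C : MClause n) (a b : Fin n) → ∃ λ y → y ∈vars C × y ≢ a × y ≢ b
third-variable C a b with x₁ C ≟ a | x₁ C ≟ b
... | no x₁≢a | no x₁≢b = x₁ C , inj₁ refl , x₁≢a , x₁≢b
... | yes refl | _ with one-of-two-avoids (d₂₃ C) b
...   | inj₁ x₂≢b = x₂ C , inj₂ (inj₁ refl) , ≢-sym (d₁₂ C) , x₂≢b
...   | inj₂ x₃≢b = x₃ C , inj₂ (inj₂ refl) , ≢-sym (d₁₃ C) , x₃≢b
third-variable C a b | no x₁≢a | yes refl with one-of-two-avoids (d₂₃ C) a
...   | inj₁ x₂≢a = x₂ C , inj₂ (inj₁ refl) , x₂≢a , ≢-sym (d₁₂ C)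
...   | inj₂ x₃≢a = x₃ C , inj₂ (inj₂ refl) , x₃≢a , ≢-sym (d₁₃ C)

Pinnable : ℕ → ℕ → Set
Pinnable n k = ∀ (H : List (MClause n)) → length H ≤ k → Sparse H →
  ∀ {a ca b cb} → (a ≡ b → ca ≡ cb) → deg a H ≤ 1 → deg b H ≤ 1 →
  PinnedColouring H a ca b cb

-- Key step: if a lies in the positive clause e, pin b and a third variable y of
-- e to ¬ ca in R, then set a to ca; a occurs in no positive clause of R.
pin-through : ∀ {a b : Fin n} {e : MClause n} {R : List (MClause n)} →
              Pinnable n k → lit a true ∈ᶜ e → length R ≤ k → Sparse (e ∷ R) →
              (a ≡ b → ca ≡ cb) → deg a (e ∷ R) ≤ 1 → deg b (e ∷ R) ≤ 1 →
              PinnedColouring (e ∷ R) a ca b cb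
pin-through {ca = ca} {cb = cb} {a = a} {b = b} {e = e} {R = R}
            pinnable a∈e len sparse consistent degA degB =
  let y , y∈e , y≢a , y≢b = third-variable e a b
      α , proper , αb , αy =
        pinnable R len (sparse-tail {H = R} e sparse) {b} {cb} {y} {not ca}
          (⊥-elim ∘′ ≢-sym y≢b)
          (≤-trans (deg-tail {H = R} {C = e}) degB)
          (deg-head {H = R} (proj₁ a∈e , y∈e) (sparse y))
      properE : sign e ≡ true → Bichromatic (α [ a ≔ ca ]) e
      properE _ = opposite⇒bichromatic {C = e} ca (proj₂ a∈e) y∈e
                    (updateAt-updates a α) (trans (updateAt-minimal y a α y≢a) αy)
  in α [ a ≔ ca ] ,
     properE ∷ update-unused (deg-zero (deg-head {H = R} a∈e degA)) proper ,
     updateAt-updates a α ,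
     update-keeps consistent αb

pin-occurring : ∀ {a b : Fin n} {H : List (MClause n)} →
                Pinnable n k → length H ≤ suc k → Sparse H → (a ≡ b → ca ≡ cb) →
                deg a H ≤ 1 → deg b H ≤ 1 → Any (λ C → lit a true ∈ᶜ C) H →
                PinnedColouring H a ca b cb
pin-occurring pinnable len sparse consistent degA degB a∈H =
  let e , R , a∈e , H↭e∷R = extract a∈H
      α , proper , αa , αb =
        pin-through pinnable a∈e (s≤s⁻¹ (subst (_≤ _) (↭-length H↭e∷R) len))
          (λ v → deg-↭ H↭e∷R (sparse v)) consistent
          (deg-↭ H↭e∷R degA) (deg-↭ H↭e∷R degB)
  in α , All-resp-↭ (↭-sym H↭e∷R) proper , αa , αb

-- A sparse list with at most k + 1 clauses has a proper assignment: for a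
-- positive head clause, pin two of its variables to opposite values in the tail.
colourable : Pinnable n k → (H : List (MClause n)) → length H ≤ suc k → Sparse H →
             ∃ λ α → Proper α H
colourable pinnable [] _ _ = const true , []
colourable pinnable (e@(mclause true u v _ u≢v _ _) ∷ R) len sparse =
  let α , proper , αu , αv =
        pinnable R (s≤s⁻¹ len) (sparse-tail {H = R} e sparse) {u} {true} {v} {false}
          (⊥-elim ∘′ u≢v)
          (deg-head {H = R} (refl , inj₁ refl) (sparse u))
          (deg-head {H = R} (refl , inj₂ (inj₁ refl)) (sparse v))
      properE : sign e ≡ true → Bichromatic α e
      properE _ = opposite⇒bichromatic {C = e} true (inj₁ refl) (inj₂ (inj₁ refl)) αu αv
  in α , properE ∷ proper
colourable pinnable (e@(mclause false _ _ _ _ _ _) ∷ R) len sparse =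
  let α , proper =
        colourable pinnable R (≤-trans (n≤1+n _) len) (sparse-tail {H = R} e sparse)
  in α , (λ ()) ∷ proper

pinning : ∀ k → Pinnable n k
pinning zero [] _ _ consistent _ _ = pin-unused {α = const true} [] [] consistent []
pinning (suc k) H len sparse {a} {ca} {b} {cb} consistent degA degB
  with any? (occurs? (lit a true)) H | any? (occurs? (lit b true)) H
... | yes a∈H | _ = pin-occurring (pinning k) len sparse consistent degA degB a∈H
... | no _ | yes b∈H =
  let α , proper , αb , αa =
        pin-occurring (pinning k) len sparse (flip-pins consistent) degB degA b∈H
  in α , proper , αa , αb
... | no a∉H | no b∉H =
  let α , proper = colourable (pinning k) H len sparse
  in pin-unused (¬Any⇒All¬ H a∉H) (¬Any⇒All¬ H b∉H) consistent proper

proper-assignment : (H : List (MClause n)) → Sparse H → ∃ λ α → Proper α H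
proper-assignment H = colourable (pinning (length H)) H (n≤1+n _)

mainTheorem5 : ∀ (n : ℕ) (I : List (MClause n)) →
    IsM3Sat22 I → NegClosed I → Satisfiable I
mainTheorem5 n I m3sat closed =
  let α , proper = proper-assignment I λ v → ≤-reflexive (IsM3Sat22.posTwo m3sat v)
  in α , All.map (λ {C} → bichromatic⇒satisfied {C = C})
                 (negClosed⇒bichromatic closed proper)
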